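{- Let $S_n=\sum_{k=0}^n\binom{n}{k}^2\binom{2k}{k}(2k+1)$ for $n\geq 0$, let $s_n=S_n/S_{n-1}$ for $n\geq 1$, and let $h(n)=9-\frac{9}{2n^2}$. Then for all $n\geq 2$, $$h(n-1)<s_n<h(n).$$ -}

module Defs where

open import Data.Nat using (ℕ; zero; suc; _+_; _*_; _∸_; _≤_; NonZero; >-nonZero; s≤s; z≤n)
open import Data.Nat.Properties using (≤-trans; ≤-refl; m≤m+n; m*n≢0)
open import Relation.Binary.PropositionalEquality using (_≡_; refl; subst)
open import Data.Nat.Combinatorics using (_C_)
open import Data.Integer using (+_)
open import Data.Rational using (ℚ; _/_; _-_)

sumTo : ℕ → (ℕ → ℕ) → ℕ
sumTo zero    f = f 0
sumTo (suc n) f = sumTo n f + f (suc n)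

term : ℕ → ℕ → ℕ
term n k = (n C k) * (n C k) * ((2 * k) C k) * (2 * k + 1)

S : ℕ → ℕ
S n = sumTo n (term n)

term-0 : ∀ n → term n 0 ≡ 1
term-0 n = refl

sumTo-≥0 : ∀ n f → f 0 ≤ sumTo n f
sumTo-≥0 zero    f = ≤-refl
sumTo-≥0 (suc n) f = ≤-trans (sumTo-≥0 n f) (m≤m+n _ _)

S-pos : ∀ m → 1 ≤ S m
S-pos m = subst (_≤ S m) (term-0 m) (sumTo-≥0 m (term m))

S-nonZero : ∀ m → NonZero (S m)
S-nonZero m = >-nonZero (S-pos m)

s : (n : ℕ) → .{{NonZero n}} → ℚ
s n = _/_ (+ S n) (S (n ∸ 1)) {{S-nonZero (n ∸ 1)}}

h : (n : ℕ) → .{{NonZero n}} → ℚ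
h n = (+ 9) / 1 - _/_ (+ 9) (2 * (n * n)) {{m*n≢0 2 (n * n) {{_}} {{m*n≢0 n n}}}}

-- Write A n = Σₖ C(n,k)² C(2k,k); the summand of S n is 2k + 1 times that of
-- A n.  Creative telescoping (Zeilberger certificates, checked pointwise as
-- polynomial identities after clearing binomial ratios) gives
-- 3 Σₖ k C(n,k)² C(2k,k) = 2n A n, so 3 S n = (4n + 3) A n, and the recurrence
-- (n+1)² A(n+1) + 9n² A(n-1) = (10n² + 10n + 3) A n.  Hence S satisfies a
-- three-term recurrence with positive coefficients.  Along such a recurrence a
-- lower (upper) bound a/b on S n / S (n-1) yields the bound a′/b′ on the next
-- ratio whenever a polynomial inequality in n holds; for the bounds h(n-1) and
-- h(n) these inequalities have explicit slack polynomials with nonnegative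
-- coefficients, so both bounds follow by induction from the first few values.

module Submission where

open import Defs
open import Data.Nat using (ℕ; suc)
open import Data.Rational using (_<_)
open import Data.Product using (_×_)

open import Data.Nat as ℕ using (zero; _+_; _*_; _∸_; _≤_; pred; z≤n; s≤s; z<s; NonZero; >-nonZero)
  renaming (_<_ to _<ₙ_)
open import Data.Nat.Properties
open import Data.Nat.Combinatorics using (_C_; nCk+nC[k+1]≡[n+1]C[k+1]; nC1≡n; nCn≡1; k>n⇒nCk≡0)
open import Data.Nat.Tactic.RingSolver using (solve-∀)
open import Data.Product using (_,_)
open import Data.Sum using (inj₁; inj₂)
import Data.Integer as ℤ
import Data.Integer.Properties as ℤ
open import Data.Rational using (_/_; _-_; -_; toℚᵘ)
open import Data.Rational.Properties using (toℚᵘ-injective; toℚᵘ-fromℚᵘ; toℚᵘ-homo-+; toℚᵘ-homo‿-; toℚᵘ-cancel-<)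
open import Data.Rational.Unnormalised as ℚᵘ using (mkℚᵘ; *≡*; *<*)
import Data.Rational.Unnormalised.Properties as ℚᵘ
open import Relation.Binary.PropositionalEquality
open import Relation.Nullary.Decidable using (from-yes)

[1+k]*[1+n]C[1+k]≡[1+n]*nCk : ∀ n k → suc k * (suc n C suc k) ≡ suc n * (n C k)
[1+k]*[1+n]C[1+k]≡[1+n]*nCk zero    zero    = refl
[1+k]*[1+n]C[1+k]≡[1+n]*nCk zero    (suc k) = *-zeroʳ (2 + k)
[1+k]*[1+n]C[1+k]≡[1+n]*nCk (suc n) zero    =
  trans (+-identityʳ _) (trans (nC1≡n (2 + n)) (sym (*-identityʳ (2 + n))))
[1+k]*[1+n]C[1+k]≡[1+n]*nCk (suc n) (suc k) = begin
  (2 + k) * (suc (suc n) C suc (suc k))      ≡⟨ cong ((2 + k) *_) (nCk+nC[k+1]≡[n+1]C[k+1] (suc n) (suc k)) ⟨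
  (2 + k) * (c + c′)                         ≡⟨ regroup (suc k) c c′ ⟩
  suc k * c + c + (2 + k) * c′               ≡⟨ cong₂ (λ x y → x + c + y) ([1+k]*[1+n]C[1+k]≡[1+n]*nCk n k)
                                                                           ([1+k]*[1+n]C[1+k]≡[1+n]*nCk n (suc k)) ⟩
  suc n * (n C k) + c + suc n * (n C suc k)  ≡⟨ regroup′ (suc n) (n C k) c (n C suc k) ⟩
  suc n * (n C k + n C suc k) + c            ≡⟨ cong (λ x → suc n * x + c) (nCk+nC[k+1]≡[n+1]C[k+1] n k) ⟩
  suc n * c + c                              ≡⟨ +-comm (suc n * c) c ⟩
  (2 + n) * c                                ∎
  where
  open ≡-Reasoning
  c  = suc n C suc k
  c′ = suc n C suc (suc k)
  regroup : ∀ x a b → (1 + x) * (a + b) ≡ x * a + a + (1 + x) * b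
  regroup = solve-∀
  regroup′ : ∀ x a b d → x * a + b + x * d ≡ x * (a + d) + b
  regroup′ = solve-∀

[1+k]*nC[1+k]≡j*nCk : ∀ {n k j} → k + j ≡ n → suc k * (n C suc k) ≡ j * (n C k)
[1+k]*nC[1+k]≡j*nCk {n} {k} {j} refl = +-cancelʳ-≡ (suc k * (n C k)) _ _ (begin
  suc k * (n C suc k) + suc k * (n C k)  ≡⟨ *-distribˡ-+ (suc k) (n C suc k) (n C k) ⟨
  suc k * (n C suc k + n C k)            ≡⟨ cong (suc k *_) (+-comm (n C suc k) (n C k)) ⟩
  suc k * (n C k + n C suc k)            ≡⟨ cong (suc k *_) (nCk+nC[k+1]≡[n+1]C[k+1] n k) ⟩
  suc k * (suc n C suc k)                ≡⟨ [1+k]*[1+n]C[1+k]≡[1+n]*nCk n k ⟩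
  suc n * (n C k)                        ≡⟨ cong (_* (n C k)) (+-comm (suc k) j) ⟩
  (j + suc k) * (n C k)                  ≡⟨ *-distribʳ-+ (n C k) j (suc k) ⟩
  j * (n C k) + suc k * (n C k)          ∎)
  where open ≡-Reasoning

[1+n]*nCk≡j*[1+n]Ck : ∀ {n k j} → k + j ≡ suc n → suc n * (n C k) ≡ j * (suc n C k)
[1+n]*nCk≡j*[1+n]Ck {n} {k} {j} k+j≡1+n =
  trans (sym ([1+k]*[1+n]C[1+k]≡[1+n]*nCk n k)) ([1+k]*nC[1+k]≡j*nCk {k = k} {j} k+j≡1+n)

[1+k]*[2+2k]C[1+k]≡2[2k+1]*2kCk : ∀ k → suc k * ((2 * suc k) C suc k) ≡ 2 * (2 * k + 1) * ((2 * k) C k)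
[1+k]*[2+2k]C[1+k]≡2[2k+1]*2kCk k = begin
  suc k * ((2 * suc k) C suc k)          ≡⟨ cong (λ x → suc k * (x C suc k)) (double-suc k) ⟩
  suc k * (suc (suc (2 * k)) C suc k)    ≡⟨ [1+k]*[1+n]C[1+k]≡[1+n]*nCk (suc (2 * k)) k ⟩
  suc (suc (2 * k)) * (suc (2 * k) C k)  ≡⟨ double-* k (suc (2 * k) C k) ⟩
  2 * (suc k * (suc (2 * k) C k))        ≡⟨ cong (2 *_) ([1+n]*nCk≡j*[1+n]Ck {2 * k} {k} (k+[1+k]≡1+2k k)) ⟨
  2 * (suc (2 * k) * ((2 * k) C k))      ≡⟨ *-assoc 2 (suc (2 * k)) _ ⟨
  2 * suc (2 * k) * ((2 * k) C k)        ≡⟨ cong (λ x → 2 * x * ((2 * k) C k)) (+-comm 1 (2 * k)) ⟩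
  2 * (2 * k + 1) * ((2 * k) C k)        ∎
  where
  open ≡-Reasoning
  double-suc : ∀ k → 2 * (1 + k) ≡ 2 + 2 * k
  double-suc = solve-∀
  double-* : ∀ k c → (2 + 2 * k) * c ≡ 2 * ((1 + k) * c)
  double-* = solve-∀
  k+[1+k]≡1+2k : ∀ k → k + (1 + k) ≡ 1 + 2 * k
  k+[1+k]≡1+2k = solve-∀

sumTo-cong : ∀ n {f g : ℕ → ℕ} → (∀ {k} → k ≤ n → f k ≡ g k) → sumTo n f ≡ sumTo n g
sumTo-cong zero    f≗g = f≗g z≤n
sumTo-cong (suc n) f≗g = cong₂ _+_ (sumTo-cong n (λ k≤n → f≗g (m≤n⇒m≤1+n k≤n))) (f≗g ≤-refl)

sumTo-+ : ∀ n (f g : ℕ → ℕ) → sumTo n (λ k → f k + g k) ≡ sumTo n f + sumTo n g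
sumTo-+ zero    f g = refl
sumTo-+ (suc n) f g = trans (cong (_+ (f (suc n) + g (suc n))) (sumTo-+ n f g))
                            (+-+-comm (sumTo n f) (sumTo n g) (f (suc n)) (g (suc n)))
  where
  +-+-comm : ∀ a b c d → a + b + (c + d) ≡ a + c + (b + d)
  +-+-comm = solve-∀

sumTo-*ˡ : ∀ n c (f : ℕ → ℕ) → sumTo n (λ k → c * f k) ≡ c * sumTo n f
sumTo-*ˡ zero    c f = refl
sumTo-*ˡ (suc n) c f = trans (cong (_+ c * f (suc n)) (sumTo-*ˡ n c f)) (sym (*-distribˡ-+ c _ _))

sumTo-linear : ∀ n a b (f g : ℕ → ℕ) →
  sumTo n (λ k → a * f k + b * g k) ≡ a * sumTo n f + b * sumTo n g
sumTo-linear n a b f g =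
  trans (sumTo-+ n (λ k → a * f k) (λ k → b * g k)) (cong₂ _+_ (sumTo-*ˡ n a f) (sumTo-*ˡ n b g))

sumTo-telescope : ∀ n (f g G : ℕ → ℕ) → (∀ {k} → k ≤ n → f k + G k ≡ g k + G (suc k)) →
  sumTo n f + G 0 ≡ sumTo n g + G (suc n)
sumTo-telescope zero    f g G step = step z≤n
sumTo-telescope (suc n) f g G step = begin
  sumTo n f + f (suc n) + G 0          ≡⟨ +-swap (sumTo n f) _ _ ⟩
  sumTo n f + G 0 + f (suc n)          ≡⟨ cong (_+ f (suc n)) (sumTo-telescope n f g G (λ k≤n → step (m≤n⇒m≤1+n k≤n))) ⟩
  sumTo n g + G (suc n) + f (suc n)    ≡⟨ +-assoc-swap (sumTo n g) _ _ ⟩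
  sumTo n g + (f (suc n) + G (suc n))  ≡⟨ cong (sumTo n g +_) (step ≤-refl) ⟩
  sumTo n g + (g (suc n) + G (2 + n))  ≡⟨ +-assoc (sumTo n g) _ _ ⟨
  sumTo n g + g (suc n) + G (2 + n)    ∎
  where
  open ≡-Reasoning
  +-swap : ∀ a b c → a + b + c ≡ a + c + b
  +-swap = solve-∀
  +-assoc-swap : ∀ a b c → a + b + c ≡ a + (c + b)
  +-assoc-swap = solve-∀

sumTo-vanishing : ∀ {n} (f : ℕ → ℕ) → (∀ {k} → n <ₙ k → f k ≡ 0) → ∀ d → sumTo (d + n) f ≡ sumTo n f
sumTo-vanishing     f f≡0 zero    = refl
sumTo-vanishing {n} f f≡0 (suc d) =
  trans (cong₂ _+_ (sumTo-vanishing f f≡0 d) (f≡0 (s≤s (m≤n+m n d)))) (+-identityʳ _)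

sumTo-telescope-vanishing : ∀ n (f g G : ℕ → ℕ) → G 0 ≡ 0 → G (suc n) ≡ 0 →
  (∀ {k} → k ≤ n → f k + G k ≡ g k + G (suc k)) → sumTo n f ≡ sumTo n g
sumTo-telescope-vanishing n f g G G0≡0 G[1+n]≡0 step = begin
  sumTo n f                ≡⟨ +-identityʳ (sumTo n f) ⟨
  sumTo n f + 0            ≡⟨ cong (sumTo n f +_) G0≡0 ⟨
  sumTo n f + G 0          ≡⟨ sumTo-telescope n f g G step ⟩
  sumTo n g + G (suc n)    ≡⟨ cong (sumTo n g +_) G[1+n]≡0 ⟩
  sumTo n g + 0            ≡⟨ +-identityʳ (sumTo n g) ⟩
  sumTo n g                ∎
  where open ≡-Reasoning

-- The sequence A and its first moment

A-term : ℕ → ℕ → ℕ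
A-term n k = (n C k) * (n C k) * ((2 * k) C k)

A : ℕ → ℕ
A n = sumTo n (A-term n)

A₁ : ℕ → ℕ
A₁ n = sumTo n (λ k → k * A-term n k)

A-term-vanishes : ∀ {n k} → n <ₙ k → A-term n k ≡ 0
A-term-vanishes n<k rewrite k>n⇒nCk≡0 n<k = refl

A-extend : ∀ n d → sumTo (d + n) (A-term n) ≡ A n
A-extend n = sumTo-vanishing (A-term n) A-term-vanishes

A₁-extend : ∀ n d → sumTo (d + n) (λ k → k * A-term n k) ≡ A₁ n
A₁-extend n = sumTo-vanishing (λ k → k * A-term n k)
  (λ {k} n<k → trans (cong (k *_) (A-term-vanishes n<k)) (*-zeroʳ k))

cong₃ : ∀ {x y z x′ y′ z′ : ℕ} (f : ℕ → ℕ → ℕ → ℕ) → x ≡ x′ → y ≡ y′ → z ≡ z′ → f x y z ≡ f x′ y′ z′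
cong₃ f refl refl refl = refl

moment-certificate : ℕ → ℕ → ℕ
moment-certificate N k = k * k * k * A-term N k

moment-certificate-algebra : ∀ {N k j a b c D D′} → k + j ≡ N →
  N * a ≡ j * c → suc k * b ≡ j * c → suc k * D′ ≡ 2 * (2 * k + 1) * D →
  N * N * (3 * (k * (a * a * D)) + 2 * (a * a * D)) + 2 * N * N * N * (c * c * D) + k * k * k * (c * c * D)
  ≡ 2 * N * N * N * (a * a * D) + 3 * N * N * (k * (c * c * D)) + suc k * suc k * suc k * (b * b * D′)
moment-certificate-algebra {k = k} {j} {a} {b} {c} {D} {D′} refl Na≡jc [1+k]b≡jc [1+k]D′≡ = begin
  N * N * (3 * (k * (a * a * D)) + 2 * (a * a * D)) + 2 * N * N * N * (c * c * D) + k * k * k * (c * c * D)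
    ≡⟨ collect k j a c D ⟩
  (3 * k + 2) * ((N * a) * (N * a) * D) + (2 * N * N * N + k * k * k) * (c * c * D)
    ≡⟨ cong (λ x → (3 * k + 2) * (x * x * D) + (2 * N * N * N + k * k * k) * (c * c * D)) Na≡jc ⟩
  (3 * k + 2) * ((j * c) * (j * c) * D) + (2 * N * N * N + k * k * k) * (c * c * D)
    ≡⟨ balance k j c D ⟩
  2 * N * ((j * c) * (j * c) * D) + 3 * N * N * (k * (c * c * D)) + (j * c) * (j * c) * (2 * (2 * k + 1) * D)
    ≡⟨ cong₃ (λ x y z → 2 * N * (x * x * D) + 3 * N * N * (k * (c * c * D)) + y * y * z) Na≡jc [1+k]b≡jc [1+k]D′≡ ⟨
  2 * N * ((N * a) * (N * a) * D) + 3 * N * N * (k * (c * c * D)) + (suc k * b) * (suc k * b) * (suc k * D′)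
    ≡⟨ spread k j a b c D D′ ⟩
  2 * N * N * N * (a * a * D) + 3 * N * N * (k * (c * c * D)) + suc k * suc k * suc k * (b * b * D′) ∎
  where
  open ≡-Reasoning
  N = k + j
  collect : ∀ k j a c D →
    (k + j) * (k + j) * (3 * (k * (a * a * D)) + 2 * (a * a * D)) + 2 * (k + j) * (k + j) * (k + j) * (c * c * D) + k * k * k * (c * c * D)
    ≡ (3 * k + 2) * (((k + j) * a) * ((k + j) * a) * D) + (2 * (k + j) * (k + j) * (k + j) + k * k * k) * (c * c * D)
  collect = solve-∀
  balance : ∀ k j c D →
    (3 * k + 2) * ((j * c) * (j * c) * D) + (2 * (k + j) * (k + j) * (k + j) + k * k * k) * (c * c * D)
    ≡ 2 * (k + j) * ((j * c) * (j * c) * D) + 3 * (k + j) * (k + j) * (k * (c * c * D)) + (j * c) * (j * c) * (2 * (2 * k + 1) * D)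
  balance = solve-∀
  spread : ∀ k j a b c D D′ →
    2 * (k + j) * (((k + j) * a) * ((k + j) * a) * D) + 3 * (k + j) * (k + j) * (k * (c * c * D)) + (suc k * b) * (suc k * b) * (suc k * D′)
    ≡ 2 * (k + j) * (k + j) * (k + j) * (a * a * D) + 3 * (k + j) * (k + j) * (k * (c * c * D)) + suc k * suc k * suc k * (b * b * D′)
  spread = solve-∀

moment-step : ∀ n → let N = suc n in
  N * N * (3 * A₁ n + 2 * A n) + 2 * N * N * N * A N ≡ 2 * N * N * N * A n + 3 * N * N * A₁ N
moment-step n = begin
  N * N * (3 * A₁ n + 2 * A n) + 2 * N * N * N * A N
    ≡⟨ cong₂ (λ x y → N * N * (3 * x + 2 * y) + 2 * N * N * N * A N) (A₁-extend n 1) (A-extend n 1) ⟨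
  N * N * (3 * sumTo N (λ k → k * A-term n k) + 2 * sumTo N (A-term n)) + 2 * N * N * N * A N
    ≡⟨ cong (λ x → N * N * x + 2 * N * N * N * A N) (sumTo-linear N 3 2 (λ k → k * A-term n k) (A-term n)) ⟨
  N * N * sumTo N f + 2 * N * N * N * A N
    ≡⟨ sumTo-linear N (N * N) (2 * N * N * N) f (A-term N) ⟨
  sumTo N (λ k → N * N * f k + 2 * N * N * N * A-term N k)
    ≡⟨ sumTo-telescope-vanishing N _ _ G refl G[1+N]≡0 pointwise ⟩
  sumTo N (λ k → 2 * N * N * N * A-term n k + 3 * N * N * (k * A-term N k))
    ≡⟨ sumTo-linear N (2 * N * N * N) (3 * N * N) (A-term n) (λ k → k * A-term N k) ⟩
  2 * N * N * N * sumTo N (A-term n) + 3 * N * N * A₁ N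
    ≡⟨ cong (λ x → 2 * N * N * N * x + 3 * N * N * A₁ N) (A-extend n 1) ⟩
  2 * N * N * N * A n + 3 * N * N * A₁ N ∎
  where
  open ≡-Reasoning
  N = suc n
  f : ℕ → ℕ
  f k = 3 * (k * A-term n k) + 2 * A-term n k
  G : ℕ → ℕ
  G = moment-certificate N
  G[1+N]≡0 : G (suc N) ≡ 0
  G[1+N]≡0 = trans (cong (suc N * suc N * suc N *_) (A-term-vanishes {N} ≤-refl)) (*-zeroʳ (suc N * suc N * suc N))
  pointwise : ∀ {k} → k ≤ N →
    N * N * f k + 2 * N * N * N * A-term N k + G k ≡ 2 * N * N * N * A-term n k + 3 * N * N * (k * A-term N k) + G (suc k)
  pointwise {k} k≤N with j , k+j≡N ← m≤n⇒∃[o]m+o≡n k≤N =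
    moment-certificate-algebra {k = k} {j} {n C k} {N C suc k} {N C k} {(2 * k) C k} {(2 * suc k) C suc k} k+j≡N
      ([1+n]*nCk≡j*[1+n]Ck {n} {k} k+j≡N) ([1+k]*nC[1+k]≡j*nCk {k = k} k+j≡N)
      ([1+k]*[2+2k]C[1+k]≡2[2k+1]*2kCk k)

3*A₁≡2n*A : ∀ n → 3 * A₁ n ≡ 2 * n * A n
3*A₁≡2n*A zero    = refl
3*A₁≡2n*A (suc n) = *-cancelˡ-≡ (3 * A₁ N) (2 * N * A N) (N * N) (begin
  N * N * (3 * A₁ N)     ≡⟨ reassoc₁ N (A₁ N) ⟩
  3 * N * N * A₁ N       ≡⟨ +-cancelˡ-≡ (2 * N * N * N * A n) _ _ shifted ⟨
  2 * N * N * N * A N    ≡⟨ reassoc₂ N (A N) ⟩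
  N * N * (2 * N * A N)  ∎)
  where
  open ≡-Reasoning
  N = suc n
  reassoc₁ : ∀ N x → N * N * (3 * x) ≡ 3 * N * N * x
  reassoc₁ = solve-∀
  reassoc₂ : ∀ N x → 2 * N * N * N * x ≡ N * N * (2 * N * x)
  reassoc₂ = solve-∀
  collect : ∀ n x → (1 + n) * (1 + n) * (2 * n * x + 2 * x) ≡ 2 * (1 + n) * (1 + n) * (1 + n) * x
  collect = solve-∀
  shifted : 2 * N * N * N * A n + 2 * N * N * N * A N ≡ 2 * N * N * N * A n + 3 * N * N * A₁ N
  shifted = begin
    2 * N * N * N * A n + 2 * N * N * N * A N             ≡⟨ cong (_+ 2 * N * N * N * A N) (collect n (A n)) ⟨
    N * N * (2 * n * A n + 2 * A n) + 2 * N * N * N * A N ≡⟨ cong (λ x → N * N * (x + 2 * A n) + 2 * N * N * N * A N) (3*A₁≡2n*A n) ⟨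
    N * N * (3 * A₁ n + 2 * A n) + 2 * N * N * N * A N    ≡⟨ moment-step n ⟩
    2 * N * N * N * A n + 3 * N * N * A₁ N                ∎

P : ℕ → ℕ
P n = 10 * n * n + 10 * n + 3

-- The factor k kills the junk value N C (0 ∸ 1) = 1 at k = 0, and the
-- truncated weight 4N + 4 ∸ 3k only occurs at k = N + 2, where N C (k ∸ 1) = 0.
recurrence-certificate : ℕ → ℕ → ℕ
recurrence-certificate N k = k * (4 * N + 4 ∸ 3 * k) * ((N C (k ∸ 1)) * (N C (k ∸ 1)) * ((2 * k) C k))

m≡n+o⇒m∸n≡o : ∀ n o {m} → m ≡ n + o → m ∸ n ≡ o
m≡n+o⇒m∸n≡o n o m≡n+o = trans (cong (_∸ n) m≡n+o) (m+n∸m≡n n o)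

4[k+j]+4∸3k≡k+4j+4 : ∀ k j → 4 * (k + j) + 4 ∸ 3 * k ≡ k + 4 * j + 4
4[k+j]+4∸3k≡k+4j+4 k j = m≡n+o⇒m∸n≡o (3 * k) (k + 4 * j + 4) (split k j)
  where
  split : ∀ k j → 4 * (k + j) + 4 ≡ 3 * k + (k + 4 * j + 4)
  split = solve-∀

4[k+j]+4∸3[1+k]≡k+4j+1 : ∀ k j → 4 * (k + j) + 4 ∸ 3 * suc k ≡ k + 4 * j + 1
4[k+j]+4∸3[1+k]≡k+4j+1 k j = m≡n+o⇒m∸n≡o (3 * suc k) (k + 4 * j + 1) (split k j)
  where
  split : ∀ k j → 4 * (k + j) + 4 ≡ 3 * (1 + k) + (k + 4 * j + 1)
  split = solve-∀

4[1+n]+4∸3[2+n]≡2+n : ∀ n → 4 * suc n + 4 ∸ 3 * (2 + n) ≡ 2 + n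
4[1+n]+4∸3[2+n]≡2+n n = m≡n+o⇒m∸n≡o (3 * (2 + n)) (2 + n) (split n)
  where
  split : ∀ n → 4 * (1 + n) + 4 ≡ 3 * (2 + n) + (2 + n)
  split = solve-∀

recurrence-certificate-algebra : ∀ {N k j a c e g D D′} → k + j ≡ N →
  N * a ≡ j * c → suc N * c ≡ suc j * e → k * (k * c) ≡ k * (suc j * g) → suc k * D′ ≡ 2 * (2 * k + 1) * D →
  P N * (c * c * D) + k * (4 * N + 4 ∸ 3 * k) * (g * g * D)
  ≡ 9 * N * N * (a * a * D) + suc N * suc N * (e * e * D) + suc k * (4 * N + 4 ∸ 3 * suc k) * (c * c * D′)
recurrence-certificate-algebra {k = k} {j} {a} {c} {e} {g} {D} {D′} refl Na≡jc Nc≡je kkc≡kjg [1+k]D′≡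
  rewrite 4[k+j]+4∸3k≡k+4j+4 k j | 4[k+j]+4∸3[1+k]≡k+4j+1 k j
  -- after multiplying by (1 + j)², every term is a polynomial multiple of c² D
  = *-cancelˡ-≡ _ _ (suc j * suc j) (begin
  suc j * suc j * (P N * (c * c * D) + k * (k + 4 * j + 4) * (g * g * D))
    ≡⟨ expose-g k j c g D ⟩
  suc j * suc j * P N * (c * c * D) + (k + 4 * j + 4) * (suc j * suc j * (k * g * g)) * D
    ≡⟨ cong (λ x → suc j * suc j * P N * (c * c * D) + (k + 4 * j + 4) * x * D) transfer-g ⟩
  suc j * suc j * P N * (c * c * D) + (k + 4 * j + 4) * (k * k * k * (c * c)) * D
    ≡⟨ balance k j c D ⟩
  9 * suc j * suc j * ((j * c) * (j * c) * D) + suc N * suc N * ((suc N * c) * (suc N * c) * D)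
    + suc j * suc j * (k + 4 * j + 1) * (c * c) * (2 * (2 * k + 1) * D)
    ≡⟨ cong₃ (λ x y z → 9 * suc j * suc j * (x * x * D) + suc N * suc N * (y * y * D) + suc j * suc j * (k + 4 * j + 1) * (c * c) * z)
             Na≡jc (sym Nc≡je) [1+k]D′≡ ⟨
  9 * suc j * suc j * ((N * a) * (N * a) * D) + suc N * suc N * ((suc j * e) * (suc j * e) * D)
    + suc j * suc j * (k + 4 * j + 1) * (c * c) * (suc k * D′)
    ≡⟨ spread k j a c e D D′ ⟩
  suc j * suc j * (9 * N * N * (a * a * D) + suc N * suc N * (e * e * D) + suc k * (k + 4 * j + 1) * (c * c * D′)) ∎)
  where
  open ≡-Reasoning
  N = k + j
  transfer-g : suc j * suc j * (k * g * g) ≡ k * k * k * (c * c)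
  transfer-g = begin
    suc j * suc j * (k * g * g)      ≡⟨ split k j g ⟩
    k * (suc j * g) * (suc j * g)    ≡⟨ cong (λ x → x * (suc j * g)) kkc≡kjg ⟨
    k * (k * c) * (suc j * g)        ≡⟨ swap k j c g ⟩
    k * c * (k * (suc j * g))        ≡⟨ cong (k * c *_) kkc≡kjg ⟨
    k * c * (k * (k * c))            ≡⟨ gather k c ⟩
    k * k * k * (c * c)              ∎
    where
    split : ∀ k j g → (1 + j) * (1 + j) * (k * g * g) ≡ k * ((1 + j) * g) * ((1 + j) * g)
    split = solve-∀
    swap : ∀ k j c g → k * (k * c) * ((1 + j) * g) ≡ k * c * (k * ((1 + j) * g))
    swap = solve-∀
    gather : ∀ k c → k * c * (k * (k * c)) ≡ k * k * k * (c * c)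
    gather = solve-∀
  expose-g : ∀ k j c g D →
    (1 + j) * (1 + j) * ((10 * (k + j) * (k + j) + 10 * (k + j) + 3) * (c * c * D) + k * (k + 4 * j + 4) * (g * g * D))
    ≡ (1 + j) * (1 + j) * (10 * (k + j) * (k + j) + 10 * (k + j) + 3) * (c * c * D) + (k + 4 * j + 4) * ((1 + j) * (1 + j) * (k * g * g)) * D
  expose-g = solve-∀
  balance : ∀ k j c D →
    (1 + j) * (1 + j) * (10 * (k + j) * (k + j) + 10 * (k + j) + 3) * (c * c * D) + (k + 4 * j + 4) * (k * k * k * (c * c)) * D
    ≡ 9 * (1 + j) * (1 + j) * ((j * c) * (j * c) * D) + (1 + (k + j)) * (1 + (k + j)) * (((1 + (k + j)) * c) * ((1 + (k + j)) * c) * D)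
      + (1 + j) * (1 + j) * (k + 4 * j + 1) * (c * c) * (2 * (2 * k + 1) * D)
  balance = solve-∀
  spread : ∀ k j a c e D D′ →
    9 * (1 + j) * (1 + j) * (((k + j) * a) * ((k + j) * a) * D) + (1 + (k + j)) * (1 + (k + j)) * (((1 + j) * e) * ((1 + j) * e) * D)
      + (1 + j) * (1 + j) * (k + 4 * j + 1) * (c * c) * ((1 + k) * D′)
    ≡ (1 + j) * (1 + j) * (9 * (k + j) * (k + j) * (a * a * D) + (1 + (k + j)) * (1 + (k + j)) * (e * e * D) + (1 + k) * (k + 4 * j + 1) * (c * c * D′))
  spread = solve-∀

recurrence-pointwise : ∀ n {k} → k ≤ 2 + n → let N = suc n in
  P N * A-term N k + recurrence-certificate N k
  ≡ 9 * N * N * A-term n k + suc N * suc N * A-term (suc N) k + recurrence-certificate N (suc k)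
recurrence-pointwise n {k} k≤2+n with m≤n⇒m<n∨m≡n k≤2+n
... | inj₁ (s≤s k≤N) with j , k+j≡N ← m≤n⇒∃[o]m+o≡n k≤N =
  recurrence-certificate-algebra {k = k} {j} {n C k} {N C k} {suc N C k} {N C (k ∸ 1)} {(2 * k) C k} {(2 * suc k) C suc k}
    k+j≡N ([1+n]*nCk≡j*[1+n]Ck {n} {k} k+j≡N) ([1+n]*nCk≡j*[1+n]Ck {N} {k} (trans (+-suc k j) (cong suc k+j≡N)))
    (kkc≡kjg k k+j≡N) ([1+k]*[2+2k]C[1+k]≡2[2k+1]*2kCk k)
  where
  N = suc n
  kkc≡kjg : ∀ k {j} → k + j ≡ N → k * (k * (N C k)) ≡ k * (suc j * (N C (k ∸ 1)))
  kkc≡kjg zero     _       = refl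
  kkc≡kjg (suc k′) {j} k+j≡N =
    cong (suc k′ *_) ([1+k]*nC[1+k]≡j*nCk {N} {k′} {suc j} (trans (+-suc k′ j) k+j≡N))
... | inj₂ refl
  rewrite A-term-vanishes {suc n} {2 + n} ≤-refl | A-term-vanishes {n} {2 + n} (m<n⇒m<1+n (n<1+n n))
        | nCn≡1 (suc n) | nCn≡1 (2 + n) | k>n⇒nCk≡0 (n<1+n (suc n))
        | 4[1+n]+4∸3[2+n]≡2+n n
  = top (P (suc n)) (9 * suc n * suc n) (2 + n) ((2 * (2 + n)) C (2 + n)) ((3 + n) * (4 * suc n + 4 ∸ 3 * (3 + n)))
  where
  top : ∀ p q m D r → p * 0 + m * m * (1 * 1 * D) ≡ q * 0 + m * m * (1 * 1 * D) + r * (0 * 0 * D)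
  top = solve-∀

A-recurrence : ∀ n → (2 + n) * (2 + n) * A (2 + n) + 9 * (1 + n) * (1 + n) * A n ≡ P (1 + n) * A (1 + n)
A-recurrence n = begin
  suc N * suc N * A (suc N) + 9 * N * N * A n
    ≡⟨ +-comm (suc N * suc N * A (suc N)) _ ⟩
  9 * N * N * A n + suc N * suc N * A (suc N)
    ≡⟨ cong (λ x → 9 * N * N * x + suc N * suc N * A (suc N)) (A-extend n 2) ⟨
  9 * N * N * sumTo (suc N) (A-term n) + suc N * suc N * A (suc N)
    ≡⟨ sumTo-linear (suc N) (9 * N * N) (suc N * suc N) (A-term n) (A-term (suc N)) ⟨
  sumTo (suc N) (λ k → 9 * N * N * A-term n k + suc N * suc N * A-term (suc N) k)
    ≡⟨ sumTo-telescope-vanishing (suc N) _ _ (recurrence-certificate N) refl G[2+N]≡0 (recurrence-pointwise n) ⟨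
  sumTo (suc N) (λ k → P N * A-term N k)
    ≡⟨ sumTo-*ˡ (suc N) (P N) (A-term N) ⟩
  P N * sumTo (suc N) (A-term N)
    ≡⟨ cong (P N *_) (A-extend N 1) ⟩
  P N * A N ∎
  where
  open ≡-Reasoning
  N = suc n
  G[2+N]≡0 : recurrence-certificate N (2 + N) ≡ 0
  G[2+N]≡0 rewrite k>n⇒nCk≡0 (n<1+n N) = *-zeroʳ ((2 + N) * (4 * N + 4 ∸ 3 * (2 + N)))

3*S≡[4n+3]*A : ∀ n → 3 * S n ≡ (4 * n + 3) * A n
3*S≡[4n+3]*A n = begin
  3 * S n                                                   ≡⟨ cong (3 *_) (sumTo-cong n (λ {k} _ → odd-weight (A-term n k) k)) ⟩
  3 * sumTo n (λ k → 2 * (k * A-term n k) + 1 * A-term n k) ≡⟨ cong (3 *_) (sumTo-linear n 2 1 (λ k → k * A-term n k) (A-term n)) ⟩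
  3 * (2 * A₁ n + 1 * A n)                                  ≡⟨ regroup (A₁ n) (A n) ⟩
  2 * (3 * A₁ n) + 3 * A n                                  ≡⟨ cong (λ x → 2 * x + 3 * A n) (3*A₁≡2n*A n) ⟩
  2 * (2 * n * A n) + 3 * A n                               ≡⟨ collect n (A n) ⟩
  (4 * n + 3) * A n                                         ∎
  where
  open ≡-Reasoning
  odd-weight : ∀ a k → a * (2 * k + 1) ≡ 2 * (k * a) + 1 * a
  odd-weight = solve-∀
  regroup : ∀ x y → 3 * (2 * x + 1 * y) ≡ 2 * (3 * x) + 3 * y
  regroup = solve-∀
  collect : ∀ n y → 2 * (2 * n * y) + 3 * y ≡ (4 * n + 3) * y
  collect = solve-∀

u₀ u₁ u₂ : ℕ → ℕ
u₀ n = 9 * (1 + n) * (1 + n) * (4 * n + 7) * (4 * n + 11)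
u₁ n = P (1 + n) * (4 * n + 3) * (4 * n + 11)
u₂ n = (2 + n) * (2 + n) * (4 * n + 3) * (4 * n + 7)

S-recurrence : ∀ n → u₂ n * S (2 + n) + u₀ n * S n ≡ u₁ n * S (1 + n)
S-recurrence n = *-cancelˡ-≡ _ _ 3 (begin
  3 * (u₂ n * S (2 + n) + u₀ n * S n)
    ≡⟨ expose n (S (2 + n)) (S n) ⟩
  (4 * n + 3) * (4 * n + 7) * ((2 + n) * (2 + n) * (3 * S (2 + n))) + (4 * n + 7) * (4 * n + 11) * (9 * (1 + n) * (1 + n) * (3 * S n))
    ≡⟨ cong₂ (λ x y → (4 * n + 3) * (4 * n + 7) * ((2 + n) * (2 + n) * x) + (4 * n + 7) * (4 * n + 11) * (9 * (1 + n) * (1 + n) * y))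
             (3*S≡[4n+3]*A (2 + n)) (3*S≡[4n+3]*A n) ⟩
  (4 * n + 3) * (4 * n + 7) * ((2 + n) * (2 + n) * ((4 * (2 + n) + 3) * A (2 + n)))
    + (4 * n + 7) * (4 * n + 11) * (9 * (1 + n) * (1 + n) * ((4 * n + 3) * A n))
    ≡⟨ factor n (A (2 + n)) (A n) ⟩
  (4 * n + 3) * (4 * n + 7) * (4 * n + 11) * ((2 + n) * (2 + n) * A (2 + n) + 9 * (1 + n) * (1 + n) * A n)
    ≡⟨ cong ((4 * n + 3) * (4 * n + 7) * (4 * n + 11) *_) (A-recurrence n) ⟩
  (4 * n + 3) * (4 * n + 7) * (4 * n + 11) * (P (1 + n) * A (1 + n))
    ≡⟨ unfactor n (P (1 + n)) (A (1 + n)) ⟩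
  P (1 + n) * (4 * n + 3) * (4 * n + 11) * ((4 * (1 + n) + 3) * A (1 + n))
    ≡⟨ cong (P (1 + n) * (4 * n + 3) * (4 * n + 11) *_) (3*S≡[4n+3]*A (1 + n)) ⟨
  P (1 + n) * (4 * n + 3) * (4 * n + 11) * (3 * S (1 + n))
    ≡⟨ hide (P (1 + n) * (4 * n + 3) * (4 * n + 11)) (S (1 + n)) ⟩
  3 * (u₁ n * S (1 + n)) ∎)
  where
  open ≡-Reasoning
  expose : ∀ n z x →
    3 * ((2 + n) * (2 + n) * (4 * n + 3) * (4 * n + 7) * z + 9 * (1 + n) * (1 + n) * (4 * n + 7) * (4 * n + 11) * x)
    ≡ (4 * n + 3) * (4 * n + 7) * ((2 + n) * (2 + n) * (3 * z)) + (4 * n + 7) * (4 * n + 11) * (9 * (1 + n) * (1 + n) * (3 * x))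
  expose = solve-∀
  factor : ∀ n z x →
    (4 * n + 3) * (4 * n + 7) * ((2 + n) * (2 + n) * ((4 * (2 + n) + 3) * z)) + (4 * n + 7) * (4 * n + 11) * (9 * (1 + n) * (1 + n) * ((4 * n + 3) * x))
    ≡ (4 * n + 3) * (4 * n + 7) * (4 * n + 11) * ((2 + n) * (2 + n) * z + 9 * (1 + n) * (1 + n) * x)
  factor = solve-∀
  unfactor : ∀ n p y → (4 * n + 3) * (4 * n + 7) * (4 * n + 11) * (p * y) ≡ p * (4 * n + 3) * (4 * n + 11) * ((4 * (1 + n) + 3) * y)
  unfactor = solve-∀
  hide : ∀ u y → u * (3 * y) ≡ 3 * (u * y)
  hide = solve-∀

-- Propagating ratio bounds through a three-term recurrence

module RatioBounds (x w r p : ℕ → ℕ) (recurrence : ∀ n → w n * x (2 + n) + r n * x n ≡ p n * x (1 + n)) where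

  private
    gather : ∀ w r a b a′ b′ Y → w * a * (a′ * Y) + r * b′ * (Y * b) ≡ (w * a * a′ + r * b * b′) * Y
    gather = solve-∀
    regroup : ∀ p a b′ Y → p * a * b′ * Y ≡ a * b′ * (p * Y)
    regroup = solve-∀
    expand : ∀ w r a b′ X Z → a * b′ * (w * Z + r * X) ≡ w * a * (Z * b′) + r * b′ * (a * X)
    expand = solve-∀

  lower-step : ∀ n {a b a′ b′} → a * x n <ₙ x (1 + n) * b →
               w n * a * a′ + r n * b * b′ ≤ p n * a * b′ → 0 <ₙ r n * b′ →
               a′ * x (1 + n) <ₙ x (2 + n) * b′
  lower-step n {a} {b} {a′} {b′} aX<Yb slack 0<rb′ =
    *-cancelˡ-< (w n * a) _ _ (+-cancelʳ-< (r n * b′ * (Y * b)) _ _ (begin-strict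
      w n * a * (a′ * Y) + r n * b′ * (Y * b)  ≡⟨ gather (w n) (r n) a b a′ b′ Y ⟩
      (w n * a * a′ + r n * b * b′) * Y        ≤⟨ *-monoˡ-≤ Y slack ⟩
      p n * a * b′ * Y                         ≡⟨ regroup (p n) a b′ Y ⟩
      a * b′ * (p n * Y)                       ≡⟨ cong (a * b′ *_) (recurrence n) ⟨
      a * b′ * (w n * Z + r n * X)             ≡⟨ expand (w n) (r n) a b′ X Z ⟩
      w n * a * (Z * b′) + r n * b′ * (a * X)  <⟨ +-monoʳ-< (w n * a * (Z * b′)) (*-monoʳ-< (r n * b′) aX<Yb) ⟩
      w n * a * (Z * b′) + r n * b′ * (Y * b)  ∎))
    where
    open ≤-Reasoning
    instance _ = >-nonZero 0<rb′
    X = x n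
    Y = x (1 + n)
    Z = x (2 + n)

  upper-step : ∀ n {a b a′ b′} → x (1 + n) * b <ₙ a * x n →
               p n * a * b′ ≤ w n * a * a′ + r n * b * b′ → 0 <ₙ r n * b′ →
               x (2 + n) * b′ <ₙ a′ * x (1 + n)
  upper-step n {a} {b} {a′} {b′} Yb<aX slack 0<rb′ =
    *-cancelˡ-< (w n * a) _ _ (+-cancelʳ-< (r n * b′ * (Y * b)) _ _ (begin-strict
      w n * a * (Z * b′) + r n * b′ * (Y * b)  <⟨ +-monoʳ-< (w n * a * (Z * b′)) (*-monoʳ-< (r n * b′) Yb<aX) ⟩
      w n * a * (Z * b′) + r n * b′ * (a * X)  ≡⟨ expand (w n) (r n) a b′ X Z ⟨
      a * b′ * (w n * Z + r n * X)             ≡⟨ cong (a * b′ *_) (recurrence n) ⟩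
      a * b′ * (p n * Y)                       ≡⟨ regroup (p n) a b′ Y ⟨
      p n * a * b′ * Y                         ≤⟨ *-monoˡ-≤ Y slack ⟩
      (w n * a * a′ + r n * b * b′) * Y        ≡⟨ gather (w n) (r n) a b a′ b′ Y ⟨
      w n * a * (a′ * Y) + r n * b′ * (Y * b)  ∎))
    where
    open ≤-Reasoning
    instance _ = >-nonZero 0<rb′
    X = x n
    Y = x (1 + n)
    Z = x (2 + n)

open RatioBounds S u₂ u₀ u₁ S-recurrence

hnum hden : ℕ → ℕ
hnum k = 9 * (2 * k * k + 4 * k + 1)
hden k = 2 * (suc k * suc k)

-- h (m + 1) < s (m + 2) and s (m + 2) < h (m + 2), cross-multiplied
Lower Upper : ℕ → Set
Lower m = hnum m * S (1 + m) <ₙ S (2 + m) * hden m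
Upper m = S (2 + m) * hden (1 + m) <ₙ hnum (1 + m) * S (1 + m)

m+d≡n⇒m≤n : ∀ {m d n} → m + d ≡ n → m ≤ n
m+d≡n⇒m≤n {m} {d} refl = m≤m+n m d

-- The side conditions of lower-step (2 + t) and upper-step (1 + m) for these
-- bounds, unfolded (the ring solver does not unfold definitions), with the
-- slack given as a polynomial with nonnegative coefficients.
lower-slack : ∀ t →
  (4 + t) * (4 + t) * (4 * (2 + t) + 3) * (4 * (2 + t) + 7)
      * (9 * (2 * (1 + t) * (1 + t) + 4 * (1 + t) + 1)) * (9 * (2 * (2 + t) * (2 + t) + 4 * (2 + t) + 1))
    + 9 * (3 + t) * (3 + t) * (4 * (2 + t) + 7) * (4 * (2 + t) + 11) * (2 * ((2 + t) * (2 + t))) * (2 * ((3 + t) * (3 + t)))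
    + (t * (t * (t * (t * (4608 * t + 61992) + 322632) + 801603) + 928584) + 380538)
  ≡ (10 * (3 + t) * (3 + t) + 10 * (3 + t) + 3) * (4 * (2 + t) + 3) * (4 * (2 + t) + 11)
      * (9 * (2 * (1 + t) * (1 + t) + 4 * (1 + t) + 1)) * (2 * ((3 + t) * (3 + t)))
lower-slack = solve-∀

upper-slack : ∀ m →
  (10 * (2 + m) * (2 + m) + 10 * (2 + m) + 3) * (4 * (1 + m) + 3) * (4 * (1 + m) + 11)
      * (9 * (2 * (1 + m) * (1 + m) + 4 * (1 + m) + 1)) * (2 * ((3 + m) * (3 + m)))
    + (m * (m * (m * (792 * m + 8280) + 32049) + 54270) + 33777)
  ≡ (3 + m) * (3 + m) * (4 * (1 + m) + 3) * (4 * (1 + m) + 7)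
      * (9 * (2 * (1 + m) * (1 + m) + 4 * (1 + m) + 1)) * (9 * (2 * (2 + m) * (2 + m) + 4 * (2 + m) + 1))
    + 9 * (2 + m) * (2 + m) * (4 * (1 + m) + 7) * (4 * (1 + m) + 11) * (2 * ((2 + m) * (2 + m))) * (2 * ((3 + m) * (3 + m)))
upper-slack = solve-∀

-- The step from Lower 0 to Lower 1 has negative slack, hence two base cases.
lower-bound : ∀ m → Lower m
lower-bound 0             = from-yes (hnum 0 * S 1 ℕ.<? S 2 * hden 0)
lower-bound 1             = from-yes (hnum 1 * S 2 ℕ.<? S 3 * hden 1)
lower-bound (suc (suc t)) =
  lower-step (2 + t) {hnum (1 + t)} {hden (1 + t)} {hnum (2 + t)} {hden (2 + t)}
    (lower-bound (suc t)) (m+d≡n⇒m≤n (lower-slack t)) z<s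

upper-bound : ∀ m → Upper m
upper-bound 0       = from-yes (S 2 * hden 1 ℕ.<? hnum 1 * S 1)
upper-bound (suc m) =
  upper-step (1 + m) {hnum (1 + m)} {hden (1 + m)} {hnum (2 + m)} {hden (2 + m)}
    (upper-bound m) (m+d≡n⇒m≤n (upper-slack m)) z<s

/-<-/ : ∀ a b c d .{{_ : NonZero b}} .{{_ : NonZero d}} → a * d <ₙ c * b → (ℤ.+ a) / b < (ℤ.+ c) / d
/-<-/ a (suc b) c (suc d) ad<cb = toℚᵘ-cancel-<
  (ℚᵘ.<-respˡ-≃ (ℚᵘ.≃-sym (toℚᵘ-fromℚᵘ (mkℚᵘ (ℤ.+ a) b))) (ℚᵘ.<-respʳ-≃ (ℚᵘ.≃-sym (toℚᵘ-fromℚᵘ (mkℚᵘ (ℤ.+ c) d)))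
    (*<* (subst₂ ℤ._<_ (ℤ.pos-* a (suc d)) (ℤ.pos-* c (suc b)) (ℤ.+<+ ad<cb)))))

9-9/q≡9[q-1]/q : ∀ q .{{_ : NonZero q}} → (ℤ.+ 9) / 1 - (ℤ.+ 9) / q ≡ (ℤ.+ (9 * pred q)) / q
9-9/q≡9[q-1]/q (suc q) = toℚᵘ-injective (begin
  toℚᵘ ((ℤ.+ 9) / 1 - (ℤ.+ 9) / suc q)                ≈⟨ toℚᵘ-homo-+ ((ℤ.+ 9) / 1) (- ((ℤ.+ 9) / suc q)) ⟩
  toℚᵘ ((ℤ.+ 9) / 1) ℚᵘ.+ toℚᵘ (- ((ℤ.+ 9) / suc q))  ≈⟨ ℚᵘ.+-cong (toℚᵘ-fromℚᵘ (mkℚᵘ (ℤ.+ 9) 0))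
                                                            (ℚᵘ.≃-trans (toℚᵘ-homo‿- ((ℤ.+ 9) / suc q))
                                                                        (ℚᵘ.-‿cong (toℚᵘ-fromℚᵘ (mkℚᵘ (ℤ.+ 9) q)))) ⟩
  mkℚᵘ (ℤ.+ 9) 0 ℚᵘ.- mkℚᵘ (ℤ.+ 9) q                  ≈⟨ *≡* (trans (cong (ℤ._* ℤ.+ suc q) numerator)
                                                                      (cong (ℤ.+ (9 * q) ℤ.*_) (sym denominator))) ⟩
  mkℚᵘ (ℤ.+ (9 * q)) q                                ≈⟨ toℚᵘ-fromℚᵘ (mkℚᵘ (ℤ.+ (9 * q)) q) ⟨
  toℚᵘ ((ℤ.+ (9 * q)) / suc q)                        ∎)
  where
  open ℚᵘ.≃-Reasoning
  numerator : ℚᵘ.↥ (mkℚᵘ (ℤ.+ 9) 0 ℚᵘ.- mkℚᵘ (ℤ.+ 9) q) ≡ ℤ.+ (9 * q)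
  numerator = trans (ℤ.⊖-≥ (m≤m*n 9 (suc q))) (cong ℤ.+_ (m≡n+o⇒m∸n≡o 9 (9 * q) (*-suc 9 q)))
  denominator : ℚᵘ.↧ (mkℚᵘ (ℤ.+ 9) 0 ℚᵘ.- mkℚᵘ (ℤ.+ 9) q) ≡ ℤ.+ suc q
  denominator = cong (λ x → ℤ.+ suc x) (+-identityʳ q)

h≡hnum/hden : ∀ k → h (suc k) ≡ (ℤ.+ hnum k) / hden k
h≡hnum/hden k = trans (9-9/q≡9[q-1]/q (hden k)) (cong (λ x → (ℤ.+ (9 * x)) / hden k) (cong pred (2[1+k]²≡1+[2k²+4k+1] k)))
  where
  2[1+k]²≡1+[2k²+4k+1] : ∀ k → 2 * (suc k * suc k) ≡ suc (2 * k * k + 4 * k + 1)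
  2[1+k]²≡1+[2k²+4k+1] = solve-∀

lemma4p4 : (m : ℕ) →
    h (suc m) < s (suc (suc m)) × s (suc (suc m)) < h (suc (suc m))
lemma4p4 m =
    subst (_< s (suc (suc m))) (sym (h≡hnum/hden m))
      (/-<-/ (hnum m) (hden m) (S (2 + m)) (S (1 + m)) {{_}} {{S-nonZero (suc m)}} (lower-bound m))
  , subst (s (suc (suc m)) <_) (sym (h≡hnum/hden (suc m)))
      (/-<-/ (S (2 + m)) (S (1 + m)) (hnum (1 + m)) (hden (1 + m)) {{S-nonZero (suc m)}} (upper-bound m))
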